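{- For every nonnegative integer $k$, $St(k+3,k)=3(k+1)$.
   Context: A strong fixed point of a permutation $\pi$ of $[n]$ is an element $k$ such that $\pi^{ -1}(j)<\pi^{ -1}(k)$ for all $j<k$ and $\pi^{ -1}(i)>\pi^{ -1}(k)$ for all $i>k$. $St(n,k)$ denotes the number of permutations of $[n]$ with exactly $k$ strong fixed points. -}

module Defs where

open import Data.Nat using (ℕ; zero; suc)
open import Data.Fin using (Fin; _<_; _>_)
open import Data.Fin.Properties using (_<?_; _≟_; all?)
open import Data.Vec using (Vec; []; _∷_; lookup)
open import Data.List using (List; []; _∷_; map; concatMap; filter; length; allFin)
open import Data.Product using (_×_)
open import Relation.Nullary using (Dec; ¬_)
open import Relation.Nullary.Decidable using (_×-dec_; _→-dec_)
open import Relation.Binary.PropositionalEquality using (_≡_)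
open import Function.Definitions using (Injective)

-- A permutation of [n] in one-line notation: w is a vector with w[i] = π(i)
-- (positions and values indexed by Fin n, i.e. [n] shifted to 0..n-1).

allVecs : (n m : ℕ) → List (Vec (Fin m) n)
allVecs zero    m = [] ∷ []
allVecs (suc n) m = concatMap (λ x → map (x ∷_) (allVecs n m)) (allFin m)

IsPerm : ∀ {n} → Vec (Fin n) n → Set
IsPerm {n} w = ∀ (p q : Fin n) → lookup w p ≡ lookup w q → p ≡ q

isPerm? : ∀ {n} (w : Vec (Fin n) n) → Dec (IsPerm w)
isPerm? {n} w = all? λ p → all? λ q → (lookup w p ≟ lookup w q) →-dec (p ≟ q)

perms : (n : ℕ) → List (Vec (Fin n) n)
perms n = filter isPerm? (allVecs n n)

IsStrongFixed : ∀ {n} → Vec (Fin n) n → Fin n → Set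
IsStrongFixed {n} w k =
  ∀ (q p : Fin n) → lookup w q ≡ k →
    ((lookup w p < k → p < q) × (lookup w p > k → p > q))

isStrongFixed? : ∀ {n} (w : Vec (Fin n) n) (k : Fin n) → Dec (IsStrongFixed w k)
isStrongFixed? w k = all? λ q → all? λ p → (lookup w q ≟ k) →-dec
  (((lookup w p <? k) →-dec (p <? q)) ×-dec ((k <? lookup w p) →-dec (q <? p)))

numStrongFixed : ∀ {n} → Vec (Fin n) n → ℕ
numStrongFixed {n} w = length (filter (isStrongFixed? w) (allFin n))

St : ℕ → ℕ → ℕ
St n k = length (filter (λ w → Data.Nat._≟_ (numStrongFixed w) k) (perms n))
  where import Data.Nat

module Submission where

-- A permutation w of [n] has a *cut* at c when it maps the initial segment
-- [0, c) onto itself.  After some counting lemmas for lists and Fin, the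
-- module StrongFixed shows that v is a strong fixed point of w exactly when
-- w has cuts at both v and v+1 (in particular w v = v, proved by counting
-- the positions below v).
--
-- A Pattern is one of the three permutations 231, 312, 321 of {0,1,2}
-- that have no cut at 1 or 2.  The block permutation with window [a, a+3)
-- and pattern σ acts by σ on the window and fixes everything else.
-- BlockPermStrong shows that its non-strong points are exactly the window,
-- ThreeNonStrong shows that every permutation with exactly three non-strong
-- points is a block permutation, and blockPerm-injective shows that window
-- and pattern are determined.  So the permutations of [k+3] with k strong
-- fixed points correspond to the (k+1)·3 pairs (window start, pattern).

open import Defs
open import Data.Nat using (ℕ; _+_; _*_)
open import Relation.Binary.PropositionalEquality using (_≡_)

open import Data.Empty using (⊥-elim)
open import Data.Fin as F using (Fin; toℕ; fromℕ<; inject≤)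
open import Data.Fin.Properties
  using (toℕ-injective; toℕ-fromℕ<; toℕ-inject≤; inject≤-injective; toℕ<n; pigeonhole; punchOut-injective)
import Data.Fin.Properties as FinProps
open import Data.List
  using (List; []; _∷_; length; filter; map; allFin; concatMap; cartesianProductWith; _++_)
open import Data.List.Membership.Propositional using (_∈_)
open import Data.List.Membership.Propositional.Properties
  using (∈-allFin; ∈-filter⁺; ∈-filter⁻; ∈-map⁺; ∈-map⁻; ∈-concatMap⁺; ∈-cartesianProductWith⁺; ∈-cartesianProductWith⁻)
open import Data.List.Membership.Propositional.Properties.WithK using (unique∧set⇒bag)
open import Data.List.Properties using (length-map; length-++; length-tabulate; filter-≐)
open import Data.List.Relation.Binary.BagAndSetEquality using (∼bag⇒↭)
open import Data.List.Relation.Binary.Permutation.Propositional.Properties using (↭-length)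
open import Data.List.Relation.Unary.All as All using ()
open import Data.List.Relation.Unary.AllPairs using (AllPairs; []; _∷_)
import Data.List.Relation.Unary.AllPairs.Properties as AllPairs
open import Data.List.Relation.Unary.Any as Any using (here; there)
open import Data.List.Relation.Unary.Unique.Propositional using (Unique)
import Data.List.Relation.Unary.Unique.Propositional.Properties as Unique
open import Data.Nat as ℕ using (zero; suc; _∸_; _≤_; _<_; z≤n; s≤s; s≤s⁻¹; _<?_)
open import Data.Nat.Properties
open import Data.Product using (Σ; ∃; _×_; _,_; proj₁; proj₂)
open import Data.Sum using (_⊎_; inj₁; inj₂)
open import Data.Vec as V using (Vec; lookup)
import Data.Vec.Properties as Vec
open import Function.Bundles using (mk⇔)
open import Relation.Binary using (tri<; tri≈; tri>)
open import Relation.Binary.PropositionalEquality using (refl; sym; trans; cong; cong₂; subst; _≢_; module ≡-Reasoning)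
open import Relation.Nullary using (yes; no; ¬_)
open import Relation.Unary using (Decidable)
open import Relation.Unary.Properties using (∁?)

length-by-members : {A : Set} {xs ys : List A} → Unique xs → Unique ys →
  (∀ {x} → x ∈ xs → x ∈ ys) → (∀ {x} → x ∈ ys → x ∈ xs) → length xs ≡ length ys
length-by-members xs! ys! xs⊆ys ys⊆xs =
  ↭-length (∼bag⇒↭ (unique∧set⇒bag xs! ys! (mk⇔ xs⊆ys ys⊆xs)))

length-filter-split : {A : Set} {P : A → Set} (P? : Decidable P) (xs : List A) →
  length (filter P? xs) + length (filter (∁? P?) xs) ≡ length xs
length-filter-split P? [] = refl
length-filter-split P? (x ∷ xs) with P? x
... | yes _ = cong suc (length-filter-split P? xs)
... | no _ = trans (+-suc _ _) (cong suc (length-filter-split P? xs))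

length-cartesianProductWith : {A B C : Set} (f : A → B → C) (xs : List A) (ys : List B) →
  length (cartesianProductWith f xs ys) ≡ length xs * length ys
length-cartesianProductWith f [] ys = refl
length-cartesianProductWith f (x ∷ xs) ys = begin
  length (map (f x) ys ++ cartesianProductWith f xs ys)
    ≡⟨ length-++ (map (f x) ys) ⟩
  length (map (f x) ys) + length (cartesianProductWith f xs ys)
    ≡⟨ cong₂ _+_ (length-map (f x) ys) (length-cartesianProductWith f xs ys) ⟩
  length ys + length xs * length ys ∎
  where open ≡-Reasoning

-- `allVecs n m` enumerates every vector exactly once; it is the iterated
-- cartesian product of `allFin m`.
concatMap≡cartesianProductWith : {A B C : Set} (f : A → B → C) (xs : List A) (ys : List B) →
  concatMap (λ x → map (f x) ys) xs ≡ cartesianProductWith f xs ys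
concatMap≡cartesianProductWith f [] ys = refl
concatMap≡cartesianProductWith f (x ∷ xs) ys =
  cong (map (f x) ys ++_) (concatMap≡cartesianProductWith f xs ys)

allVecs-complete : ∀ {n m} (v : Vec (Fin m) n) → v ∈ allVecs n m
allVecs-complete V.[] = here refl
allVecs-complete {suc n} {m} (x V.∷ v) =
  ∈-concatMap⁺ (λ y → map (y V.∷_) (allVecs n m))
    (Any.map (λ { refl → ∈-map⁺ (x V.∷_) (allVecs-complete v) }) (∈-allFin x))

allVecs-unique : ∀ n m → Unique (allVecs n m)
allVecs-unique zero m = All.[] ∷ []
allVecs-unique (suc n) m rewrite concatMap≡cartesianProductWith V._∷_ (allFin m) (allVecs n m) =
  Unique.cartesianProductWith⁺ V._∷_ Vec.∷-injective (Unique.allFin⁺ m) (allVecs-unique n m)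

perms-unique : ∀ n → Unique (perms n)
perms-unique n = Unique.filter⁺ isPerm? (allVecs-unique n n)

perms-complete : ∀ {n} (w : Vec (Fin n) n) → IsPerm w → w ∈ perms n
perms-complete w w-perm = ∈-filter⁺ isPerm? (allVecs-complete w) w-perm

lookup-extensional : ∀ {A : Set} {n} {xs ys : Vec A n} → (∀ i → lookup xs i ≡ lookup ys i) → xs ≡ ys
lookup-extensional {xs = xs} {ys} same =
  trans (sym (Vec.tabulate∘lookup xs)) (trans (Vec.tabulate-cong same) (Vec.tabulate∘lookup ys))

injective⇒surjective : ∀ {m} (f : Fin m → Fin m) → (∀ p q → f p ≡ f q → p ≡ q) →
  ∀ v → ∃ λ q → f q ≡ v
injective⇒surjective {suc m} f f-inj v with FinProps.any? (λ q → f q FinProps.≟ v)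
... | yes hit = hit
... | no miss with pigeonhole (n<1+n m) (λ p → F.punchOut {i = v} (λ v≡fp → miss (p , sym v≡fp)))
... | i , j , i<j , eq = ⊥-elim (FinProps.<⇒≢ i<j (f-inj i j (punchOut-injective {i = v} _ _ eq)))

-- Exactly c elements of Fin n lie below c (for c ≤ n): they are the
-- injected elements of Fin c.
count-below : ∀ {n} c → c ≤ n → length (filter (λ p → toℕ p <? c) (allFin n)) ≡ c
count-below {n} c c≤n = begin
  length (filter below? (allFin n))  ≡⟨ length-by-members below-unique injected-unique below⇒injected injected⇒below ⟩
  length injected                    ≡⟨ length-map _ (allFin c) ⟩
  length (allFin c)                  ≡⟨ length-tabulate (λ i → i) ⟩
  c                                  ∎
  where
  open ≡-Reasoning
  below? = λ (p : Fin n) → toℕ p <? c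
  injected = map (λ i → inject≤ i c≤n) (allFin c)

  below-unique : Unique (filter below? (allFin n))
  below-unique = Unique.filter⁺ below? (Unique.allFin⁺ n)
  injected-unique : Unique injected
  injected-unique = Unique.map⁺ (λ {i} {j} → inject≤-injective c≤n c≤n i j) (Unique.allFin⁺ c)

  below⇒injected : ∀ {p} → p ∈ filter below? (allFin n) → p ∈ injected
  below⇒injected {p} p∈ with ∈-filter⁻ below? {xs = allFin n} p∈
  ... | _ , p<c = subst (_∈ injected) (toℕ-injective (trans (toℕ-inject≤ _ c≤n) (toℕ-fromℕ< p<c)))
                        (∈-map⁺ (λ i → inject≤ i c≤n) (∈-allFin (fromℕ< p<c)))
  injected⇒below : ∀ {p} → p ∈ injected → p ∈ filter below? (allFin n)
  injected⇒below {p} p∈ with ∈-map⁻ (λ i → inject≤ i c≤n) p∈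
  ... | i , _ , refl = ∈-filter⁺ below? (∈-allFin p) (subst (_< c) (sym (toℕ-inject≤ i c≤n)) (toℕ<n i))

-- Precomposing a predicate with a bijection of Fin n does not change how
-- many elements satisfy it: f maps the first filtered list onto the second.
count-∘-injective : ∀ {n} (f : Fin n → Fin n) → (∀ p q → f p ≡ f q → p ≡ q) →
  {P : Fin n → Set} (P? : Decidable P) →
  length (filter (λ p → P? (f p)) (allFin n)) ≡ length (filter P? (allFin n))
count-∘-injective {n} f f-inj P? = begin
  length (filter P∘f? (allFin n))           ≡⟨ sym (length-map f (filter P∘f? (allFin n))) ⟩
  length (map f (filter P∘f? (allFin n)))   ≡⟨ length-by-members image-unique (Unique.filter⁺ P? (Unique.allFin⁺ n))
                                                 image⇒P P⇒image ⟩
  length (filter P? (allFin n))             ∎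
  where
  open ≡-Reasoning
  P∘f? = λ p → P? (f p)

  image-unique : Unique (map f (filter P∘f? (allFin n)))
  image-unique = Unique.map⁺ (λ {x} {y} → f-inj x y) (Unique.filter⁺ P∘f? (Unique.allFin⁺ n))

  image⇒P : ∀ {x} → x ∈ map f (filter P∘f? (allFin n)) → x ∈ filter P? (allFin n)
  image⇒P x∈ with ∈-map⁻ f x∈
  ... | y , y∈ , refl = ∈-filter⁺ P? (∈-allFin (f y)) (proj₂ (∈-filter⁻ P∘f? {xs = allFin n} y∈))
  P⇒image : ∀ {x} → x ∈ filter P? (allFin n) → x ∈ map f (filter P∘f? (allFin n))
  P⇒image {x} x∈ with injective⇒surjective f f-inj x
  ... | y , refl = ∈-map⁺ f (∈-filter⁺ P∘f? (∈-allFin y) (proj₂ (∈-filter⁻ P? {xs = allFin n} x∈)))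

module StrongFixed {n : ℕ} (w : Vec (Fin n) n) (w-perm : IsPerm w) where

  W : Fin n → Fin n
  W = lookup w

  W-injective : ∀ p q → toℕ (W p) ≡ toℕ (W q) → p ≡ q
  W-injective p q eq = w-perm p q (toℕ-injective eq)

  preimage-unique : ∀ {p q v} → W q ≡ v → toℕ (W p) ≡ toℕ v → p ≡ q
  preimage-unique {p} {q} Wq≡v Wp≡v = W-injective p q (trans Wp≡v (cong toℕ (sym Wq≡v)))

  Cut : ℕ → Set
  Cut c = ∀ p → (toℕ p < c → toℕ (W p) < c) × (toℕ (W p) < c → toℕ p < c)

  cut-zero : Cut 0
  cut-zero p = (λ ()) , (λ ())

  cut-beyond : ∀ c → n ≤ c → Cut c
  cut-beyond c n≤c p = (λ _ → <-≤-trans (toℕ<n (W p)) n≤c) , (λ _ → <-≤-trans (toℕ<n p) n≤c)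

  cut-step : ∀ v → W v ≡ v → Cut (toℕ v) → Cut (suc (toℕ v))
  cut-step v fixed cut p = (forth , back)
    where
    forth : toℕ p < suc (toℕ v) → toℕ (W p) < suc (toℕ v)
    forth (s≤s p≤v) with m≤n⇒m<n∨m≡n p≤v
    ... | inj₁ p<v = m<n⇒m<1+n (proj₁ (cut p) p<v)
    ... | inj₂ p≡v rewrite toℕ-injective {i = p} {j = v} p≡v | fixed = n<1+n (toℕ v)
    back : toℕ (W p) < suc (toℕ v) → toℕ p < suc (toℕ v)
    back (s≤s Wp≤v) with m≤n⇒m<n∨m≡n Wp≤v
    ... | inj₁ Wp<v = m<n⇒m<1+n (proj₂ (cut p) Wp<v)
    ... | inj₂ Wp≡v = s≤s (≤-reflexive (cong toℕ (preimage-unique fixed Wp≡v)))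

  cut-unstep : ∀ v → W v ≡ v → Cut (suc (toℕ v)) → Cut (toℕ v)
  cut-unstep v fixed cut p = (forth , back)
    where
    forth : toℕ p < toℕ v → toℕ (W p) < toℕ v
    forth p<v = ≤∧≢⇒< (s≤s⁻¹ (proj₁ (cut p) (m<n⇒m<1+n p<v)))
                      (λ Wp≡v → <⇒≢ p<v (cong toℕ (preimage-unique fixed Wp≡v)))
    back : toℕ (W p) < toℕ v → toℕ p < toℕ v
    back Wp<v = ≤∧≢⇒< (s≤s⁻¹ (proj₂ (cut p) (m<n⇒m<1+n Wp<v)))
                      (λ p≡v → <⇒≢ Wp<v (cong toℕ (trans (cong W (toℕ-injective p≡v)) fixed)))

  before-strong : ∀ {v q} → IsStrongFixed w v → W q ≡ v →
    ∀ p → toℕ p < toℕ q → toℕ (W p) < toℕ v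
  before-strong {v} {q} strong Wq≡v p p<q with <-cmp (toℕ (W p)) (toℕ v)
  ... | tri< Wp<v _ _ = Wp<v
  ... | tri≈ _ Wp≡v _ = ⊥-elim (<⇒≢ p<q (cong toℕ (preimage-unique Wq≡v Wp≡v)))
  ... | tri> _ _ Wp>v = ⊥-elim (<-asym p<q (proj₂ (strong q p Wq≡v) Wp>v))

  -- A strong fixed point is fixed: if W q = v then both the positions before
  -- q and the values below v number exactly the positions p with W p < v,
  -- so q = v.
  strong⇒fixed : ∀ v → IsStrongFixed w v → W v ≡ v
  strong⇒fixed v strong with injective⇒surjective W w-perm v
  ... | q , Wq≡v = subst (λ x → W x ≡ v) q≡v Wq≡v
    where
    open ≡-Reasoning
    q≡v : q ≡ v
    q≡v = toℕ-injective (begin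
      toℕ q
        ≡⟨ sym (count-below (toℕ q) (<⇒≤ (toℕ<n q))) ⟩
      length (filter (λ p → toℕ p <? toℕ q) (allFin n))
        ≡⟨ cong length (filter-≐ (λ p → toℕ p <? toℕ q) (λ p → toℕ (W p) <? toℕ v)
             ((λ {p} → before-strong strong Wq≡v p) , (λ {p} → proj₁ (strong q p Wq≡v)))
             (allFin n)) ⟩
      length (filter (λ p → toℕ (W p) <? toℕ v) (allFin n))
        ≡⟨ count-∘-injective W w-perm (λ u → toℕ u <? toℕ v) ⟩
      length (filter (λ u → toℕ u <? toℕ v) (allFin n))
        ≡⟨ count-below (toℕ v) (<⇒≤ (toℕ<n v)) ⟩
      toℕ v ∎)

  strong⇒cuts : ∀ v → IsStrongFixed w v → Cut (toℕ v) × Cut (suc (toℕ v))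
  strong⇒cuts v strong = cut-v , cut-step v fixed cut-v
    where
    fixed = strong⇒fixed v strong
    cut-v : Cut (toℕ v)
    cut-v p = before-strong strong fixed p , proj₁ (strong v p fixed)

  cuts⇒strong : ∀ v → Cut (toℕ v) → Cut (suc (toℕ v)) → IsStrongFixed w v
  cuts⇒strong v cut-v cut-v+1 q p Wq≡v = before , after
    where
    q≡v : toℕ q ≡ toℕ v
    q≡v = ≤-antisym (s≤s⁻¹ (proj₂ (cut-v+1 q) (s≤s (≤-reflexive (cong toℕ Wq≡v)))))
                    (≮⇒≥ (λ q<v → <-irrefl (cong toℕ Wq≡v) (proj₁ (cut-v q) q<v)))
    before : toℕ (W p) < toℕ v → toℕ p < toℕ q
    before Wp<v = subst (toℕ p <_) (sym q≡v) (proj₂ (cut-v p) Wp<v)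
    after : toℕ v < toℕ (W p) → toℕ q < toℕ p
    after v<Wp = ≰⇒> λ p≤q → <⇒≱ v<Wp (s≤s⁻¹ (proj₁ (cut-v+1 p) (s≤s (subst (toℕ p ≤_) q≡v p≤q))))

-- The permutations of {0,1,2} with no cut at 1 or 2 (the indecomposable
-- ones), named by their one-line notation on {1,2,3}.
data Pattern : Set where
  p231 p312 p321 : Pattern

patterns : List Pattern
patterns = p231 ∷ p312 ∷ p321 ∷ []

patterns-unique : Unique patterns
patterns-unique = ((λ ()) All.∷ (λ ()) All.∷ All.[]) ∷ ((λ ()) All.∷ All.[]) ∷ All.[] ∷ []

patterns-complete : ∀ σ → σ ∈ patterns
patterns-complete p231 = here refl
patterns-complete p312 = there (here refl)
patterns-complete p321 = there (there (here refl))

-- The action of a pattern on the offsets 0, 1, 2 (0-based).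
image : Pattern → ℕ → ℕ
image p231 0 = 1
image p231 1 = 2
image p231 _ = 0
image p312 0 = 2
image p312 1 = 0
image p312 _ = 1
image p321 0 = 2
image p321 1 = 1
image p321 _ = 0

image<3 : ∀ σ s → image σ s < 3
image<3 p231 0 = s≤s (s≤s z≤n)
image<3 p231 1 = s≤s (s≤s (s≤s z≤n))
image<3 p231 (suc (suc s)) = s≤s z≤n
image<3 p312 0 = s≤s (s≤s (s≤s z≤n))
image<3 p312 1 = s≤s z≤n
image<3 p312 (suc (suc s)) = s≤s (s≤s z≤n)
image<3 p321 0 = s≤s (s≤s (s≤s z≤n))
image<3 p321 1 = s≤s (s≤s z≤n)
image<3 p321 (suc (suc s)) = s≤s z≤n

-- 231 and 312 are inverse to each other, 321 is an involution; hence every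
-- pattern acts injectively on {0,1,2}.
inverse : Pattern → Pattern
inverse p231 = p312
inverse p312 = p231
inverse p321 = p321

image-inverse : ∀ σ s → s < 3 → image (inverse σ) (image σ s) ≡ s
image-inverse p231 0 _ = refl
image-inverse p231 1 _ = refl
image-inverse p231 2 _ = refl
image-inverse p312 0 _ = refl
image-inverse p312 1 _ = refl
image-inverse p312 2 _ = refl
image-inverse p321 0 _ = refl
image-inverse p321 1 _ = refl
image-inverse p321 2 _ = refl
image-inverse σ (suc (suc (suc _))) (s≤s (s≤s (s≤s ())))

image-injective : ∀ σ s t → s < 3 → t < 3 → image σ s ≡ image σ t → s ≡ t
image-injective σ s t s<3 t<3 eq =
  trans (sym (image-inverse σ s s<3)) (trans (cong (image (inverse σ)) eq) (image-inverse σ t t<3))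

-- No pattern has a cut at 1: offset 0 is moved up ...
image-0-moves : ∀ σ → 1 ≤ image σ 0
image-0-moves p231 = s≤s z≤n
image-0-moves p312 = s≤s z≤n
image-0-moves p321 = s≤s z≤n

-- ... and none has a cut at 2: some offset below 2 is sent to 2.
reaches-2 : ∀ σ → Σ ℕ λ s → s < 2 × image σ s ≡ 2
reaches-2 p231 = 1 , s≤s (s≤s z≤n) , refl
reaches-2 p312 = 0 , s≤s z≤n , refl
reaches-2 p321 = 0 , s≤s z≤n , refl

pattern-determined : ∀ σ τ → image σ 0 ≡ image τ 0 → image σ 1 ≡ image τ 1 → σ ≡ τ
pattern-determined p231 p231 _ _ = refl
pattern-determined p312 p312 _ _ = refl
pattern-determined p321 p321 _ _ = refl
pattern-determined p231 p312 () _
pattern-determined p231 p321 () _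
pattern-determined p312 p231 () _
pattern-determined p321 p231 () _
pattern-determined p312 p321 _ ()
pattern-determined p321 p312 _ ()

classify-pattern : ∀ t0 t1 t2 → t0 < 3 → t1 < 3 → t2 < 3 →
  t0 ≢ t1 → t0 ≢ t2 → t1 ≢ t2 → t0 ≢ 0 → t2 ≢ 2 →
  Σ Pattern λ σ → image σ 0 ≡ t0 × image σ 1 ≡ t1 × image σ 2 ≡ t2
classify-pattern (suc (suc (suc _))) _ _ (s≤s (s≤s (s≤s ()))) _ _ _ _ _ _ _
classify-pattern _ (suc (suc (suc _))) _ _ (s≤s (s≤s (s≤s ()))) _ _ _ _ _ _
classify-pattern _ _ (suc (suc (suc _))) _ _ (s≤s (s≤s (s≤s ()))) _ _ _ _ _
classify-pattern 0 _ _ _ _ _ _ _ _ t0≢0 _ = ⊥-elim (t0≢0 refl)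
classify-pattern _ _ 2 _ _ _ _ _ _ _ t2≢2 = ⊥-elim (t2≢2 refl)
classify-pattern 1 2 0 _ _ _ _ _ _ _ _ = p231 , refl , refl , refl
classify-pattern 2 0 1 _ _ _ _ _ _ _ _ = p312 , refl , refl , refl
classify-pattern 2 1 0 _ _ _ _ _ _ _ _ = p321 , refl , refl , refl
classify-pattern 1 1 _ _ _ _ t0≢t1 _ _ _ _ = ⊥-elim (t0≢t1 refl)
classify-pattern 2 2 _ _ _ _ t0≢t1 _ _ _ _ = ⊥-elim (t0≢t1 refl)
classify-pattern 1 _ 1 _ _ _ _ t0≢t2 _ _ _ = ⊥-elim (t0≢t2 refl)
classify-pattern _ 0 0 _ _ _ _ _ t1≢t2 _ _ = ⊥-elim (t1≢t2 refl)
classify-pattern _ 1 1 _ _ _ _ _ t1≢t2 _ _ = ⊥-elim (t1≢t2 refl)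

0<3 : 0 < 3
0<3 = s≤s z≤n

1<3 : 1 < 3
1<3 = s≤s (s≤s z≤n)

2<3 : 2 < 3
2<3 = s≤s (s≤s (s≤s z≤n))

Outside : ℕ → ℕ → Set
Outside a p = p < a ⊎ a + 3 ≤ p

data Window (a p : ℕ) : Set where
  outside : Outside a p → Window a p
  inside  : ∀ s → s < 3 → p ≡ a + s → Window a p

window : ∀ a p → Window a p
window a p with p <? a
... | yes p<a = outside (inj₁ p<a)
... | no p≮a with p <? a + 3
... | no p≮a+3 = outside (inj₂ (≮⇒≥ p≮a+3))
... | yes p<a+3 = inside (p ∸ a) (+-cancelˡ-< a _ _ (subst (_< a + 3) (sym a+[p∸a]≡p) p<a+3)) (sym a+[p∸a]≡p)
  where
  a+[p∸a]≡p : a + (p ∸ a) ≡ p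
  a+[p∸a]≡p = m+[n∸m]≡n (≮⇒≥ p≮a)

inside-not-outside : ∀ a s → s < 3 → ¬ Outside a (a + s)
inside-not-outside a s s<3 (inj₁ a+s<a) = <⇒≱ a+s<a (m≤m+n a s)
inside-not-outside a s s<3 (inj₂ a+3≤a+s) = <⇒≱ (+-monoʳ-< a s<3) a+3≤a+s

shuffle : ℕ → Pattern → ℕ → ℕ
shuffle a σ p with p <? a
... | yes _ = p
... | no _ with p <? a + 3
... | yes _ = a + image σ (p ∸ a)
... | no _ = p

shuffle-outside : ∀ a σ p → Outside a p → shuffle a σ p ≡ p
shuffle-outside a σ p out with p <? a
... | yes _ = refl
... | no p≮a with p <? a + 3 | out
... | yes _ | inj₁ p<a = ⊥-elim (p≮a p<a)
... | yes p<a+3 | inj₂ a+3≤p = ⊥-elim (<⇒≱ p<a+3 a+3≤p)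
... | no _ | _ = refl

shuffle-inside : ∀ a σ s → s < 3 → shuffle a σ (a + s) ≡ a + image σ s
shuffle-inside a σ s s<3 with (a + s) <? a
... | yes a+s<a = ⊥-elim (inside-not-outside a s s<3 (inj₁ a+s<a))
... | no _ with (a + s) <? a + 3
... | yes _ = cong (λ x → a + image σ x) (m+n∸m≡n a s)
... | no a+s≮a+3 = ⊥-elim (a+s≮a+3 (+-monoʳ-< a s<3))

shuffle-injective : ∀ a σ p q → shuffle a σ p ≡ shuffle a σ q → p ≡ q
shuffle-injective a σ p q eq with window a p | window a q
... | outside p-out | outside q-out =
  trans (sym (shuffle-outside a σ p p-out)) (trans eq (shuffle-outside a σ q q-out))
... | outside p-out | inside t t<3 refl =
  ⊥-elim (inside-not-outside a (image σ t) (image<3 σ t)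
    (subst (Outside a) (trans (sym (shuffle-outside a σ p p-out)) (trans eq (shuffle-inside a σ t t<3))) p-out))
... | inside s s<3 refl | outside q-out =
  ⊥-elim (inside-not-outside a (image σ s) (image<3 σ s)
    (subst (Outside a) (trans (sym (shuffle-outside a σ q q-out)) (trans (sym eq) (shuffle-inside a σ s s<3))) q-out))
... | inside s s<3 refl | inside t t<3 refl =
  cong (a +_) (image-injective σ s t s<3 t<3
    (+-cancelˡ-≡ a _ _ (trans (sym (shuffle-inside a σ s s<3)) (trans eq (shuffle-inside a σ t t<3)))))

shuffle-bounded : ∀ a σ {n} p → a + 3 ≤ n → p < n → shuffle a σ p < n
shuffle-bounded a σ p a+3≤n p<n with window a p
... | outside out = subst (_< _) (sym (shuffle-outside a σ p out)) p<n
... | inside s s<3 refl =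
  subst (_< _) (sym (shuffle-inside a σ s s<3)) (<-≤-trans (+-monoʳ-< a (image<3 σ s)) a+3≤n)

shuffle-cut : ∀ a σ c → c ≤ a ⊎ a + 3 ≤ c →
  ∀ p → (p < c → shuffle a σ p < c) × (shuffle a σ p < c → p < c)
shuffle-cut a σ c c-out p with window a p
... | outside out rewrite shuffle-outside a σ p out = (λ p<c → p<c) , (λ p<c → p<c)
... | inside s s<3 refl rewrite shuffle-inside a σ s s<3 with c-out
... | inj₁ c≤a = (λ a+s<c → ⊥-elim (<⇒≱ a+s<c (≤-trans c≤a (m≤m+n a s))))
               , (λ a+t<c → ⊥-elim (<⇒≱ a+t<c (≤-trans c≤a (m≤m+n a _))))
... | inj₂ a+3≤c = (λ _ → <-≤-trans (+-monoʳ-< a (image<3 σ s)) a+3≤c)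
                 , (λ _ → <-≤-trans (+-monoʳ-< a s<3) a+3≤c)

blockPerm : ∀ {n} a → .(a + 3 ≤ n) → Pattern → Vec (Fin n) n
blockPerm a a+3≤n σ = V.tabulate (λ p → fromℕ< (shuffle-bounded a σ (toℕ p) a+3≤n (toℕ<n p)))

blockPerm-lookup : ∀ {n} a .(a+3≤n : a + 3 ≤ n) σ p →
  toℕ (lookup (blockPerm a a+3≤n σ) p) ≡ shuffle a σ (toℕ p)
blockPerm-lookup a a+3≤n σ p =
  trans (cong toℕ (Vec.lookup∘tabulate _ p)) (toℕ-fromℕ< _)

blockPerm-isPerm : ∀ {n} a .(a+3≤n : a + 3 ≤ n) σ → IsPerm (blockPerm {n} a a+3≤n σ)
blockPerm-isPerm a a+3≤n σ p q eq = toℕ-injective (shuffle-injective a σ (toℕ p) (toℕ q)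
  (trans (sym (blockPerm-lookup a a+3≤n σ p)) (trans (cong toℕ eq) (blockPerm-lookup a a+3≤n σ q))))

windowPoint : ∀ {n} a → .(a + 3 ≤ n) → ∀ s → s < 3 → Fin n
windowPoint a a+3≤n s s<3 = fromℕ< (<-≤-trans (+-monoʳ-< a s<3) a+3≤n)

toℕ-windowPoint : ∀ {n} a .(a+3≤n : a + 3 ≤ n) s s<3 → toℕ (windowPoint a a+3≤n s s<3) ≡ a + s
toℕ-windowPoint a a+3≤n s s<3 = toℕ-fromℕ< _

nonStrong : ∀ {n} → Vec (Fin n) n → List (Fin n)
nonStrong {n} w = filter (∁? (isStrongFixed? w)) (allFin n)

strong+nonStrong : ∀ {n} (w : Vec (Fin n) n) → numStrongFixed w + length (nonStrong w) ≡ n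
strong+nonStrong {n} w = trans (length-filter-split (isStrongFixed? w) (allFin n)) (length-tabulate (λ i → i))

-- A block permutation has exactly the three window points as non-strong
-- fixed points: outside the window it has cuts on both sides of every
-- point, inside the window the pattern has no cut at 1 or 2.
module BlockPermStrong {n : ℕ} (a : ℕ) (a+3≤n : a + 3 ≤ n) (σ : Pattern) where

  w : Vec (Fin n) n
  w = blockPerm a a+3≤n σ

  open StrongFixed w (blockPerm-isPerm a a+3≤n σ)

  weak? : Decidable (λ v → ¬ IsStrongFixed w v)
  weak? = ∁? (isStrongFixed? w)

  cut-off-window : ∀ c → c ≤ a ⊎ a + 3 ≤ c → Cut c
  cut-off-window c c-out p rewrite blockPerm-lookup a a+3≤n σ p = shuffle-cut a σ c c-out (toℕ p)

  strong-outside : ∀ v → Outside a (toℕ v) → IsStrongFixed w v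
  strong-outside v (inj₁ v<a) = cuts⇒strong v (cut-off-window _ (inj₁ (<⇒≤ v<a))) (cut-off-window _ (inj₁ v<a))
  strong-outside v (inj₂ a+3≤v) =
    cuts⇒strong v (cut-off-window _ (inj₂ a+3≤v)) (cut-off-window _ (inj₂ (m≤n⇒m≤1+n a+3≤v)))

  at : ∀ s → s < 3 → Fin n
  at = windowPoint a a+3≤n

  toℕ-at : ∀ s s<3 → toℕ (at s s<3) ≡ a + s
  toℕ-at = toℕ-windowPoint a a+3≤n

  W-at : ∀ s s<3 → toℕ (W (at s s<3)) ≡ a + image σ s
  W-at s s<3 = trans (blockPerm-lookup a a+3≤n σ (at s s<3))
                     (trans (cong (shuffle a σ) (toℕ-at s s<3)) (shuffle-inside a σ s s<3))

  -- Inside the window the cuts at a+1 and a+2 fail, because the pattern is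
  -- indecomposable.
  no-cut-1 : ¬ Cut (a + 1)
  no-cut-1 cut = <⇒≱ (subst (_< a + 1) (W-at 0 0<3) (proj₁ (cut (at 0 0<3)) at-0<a+1))
                     (+-monoʳ-≤ a (image-0-moves σ))
    where
    at-0<a+1 : toℕ (at 0 0<3) < a + 1
    at-0<a+1 = subst (_< a + 1) (sym (toℕ-at 0 0<3)) (+-monoʳ-< a (s≤s z≤n))

  no-cut-2 : ¬ Cut (a + 2)
  no-cut-2 cut with reaches-2 σ
  ... | s , s<2 , σs≡2 = <-irrefl (cong (a +_) σs≡2)
                          (subst (_< a + 2) (W-at s s<3) (proj₁ (cut (at s s<3)) at-s<a+2))
    where
    s<3 : s < 3
    s<3 = m<n⇒m<1+n s<2
    at-s<a+2 : toℕ (at s s<3) < a + 2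
    at-s<a+2 = subst (_< a + 2) (sym (toℕ-at s s<3)) (+-monoʳ-< a s<2)

  -- Each window point lacks a cut on one of its sides.
  not-strong-inside : ∀ s s<3 → ¬ IsStrongFixed w (at s s<3)
  not-strong-inside 0 s<3 strong =
    no-cut-1 (subst Cut (trans (cong suc (toℕ-at 0 s<3)) (sym (+-suc a 0))) (proj₂ (strong⇒cuts _ strong)))
  not-strong-inside 1 s<3 strong = no-cut-1 (subst Cut (toℕ-at 1 s<3) (proj₁ (strong⇒cuts _ strong)))
  not-strong-inside 2 s<3 strong = no-cut-2 (subst Cut (toℕ-at 2 s<3) (proj₁ (strong⇒cuts _ strong)))
  not-strong-inside (suc (suc (suc _))) (s≤s (s≤s (s≤s ())))

  windowPoints : List (Fin n)
  windowPoints = at 0 0<3 ∷ at 1 1<3 ∷ at 2 2<3 ∷ []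

  windowPoints-unique : Unique windowPoints
  windowPoints-unique = (distinct 0 1 0<3 1<3 (λ ()) All.∷ distinct 0 2 0<3 2<3 (λ ()) All.∷ All.[])
                      ∷ (distinct 1 2 1<3 2<3 (λ ()) All.∷ All.[]) ∷ All.[] ∷ []
    where
    distinct : ∀ s t s<3 t<3 → s ≢ t → at s s<3 ≢ at t t<3
    distinct s t s<3 t<3 s≢t eq =
      s≢t (+-cancelˡ-≡ a s t (trans (sym (toℕ-at s s<3)) (trans (cong toℕ eq) (toℕ-at t t<3))))

  nonStrong⇒window : ∀ {v} → v ∈ nonStrong w → v ∈ windowPoints
  nonStrong⇒window {v} v∈ with window a (toℕ v)
  ... | outside out = ⊥-elim (proj₂ (∈-filter⁻ weak? {xs = allFin n} v∈) (strong-outside v out))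
  ... | inside s s<3 v≡a+s with toℕ-injective {i = v} {j = at s s<3} (trans v≡a+s (sym (toℕ-at s s<3)))
  ... | refl = in-window s s<3
    where
    in-window : ∀ s s<3 → at s s<3 ∈ windowPoints
    in-window 0 (s≤s z≤n) = here refl
    in-window 1 (s≤s (s≤s z≤n)) = there (here refl)
    in-window 2 (s≤s (s≤s (s≤s z≤n))) = there (there (here refl))
    in-window (suc (suc (suc _))) (s≤s (s≤s (s≤s ())))

  window⇒nonStrong : ∀ {v} → v ∈ windowPoints → v ∈ nonStrong w
  window⇒nonStrong {v} (here refl) = ∈-filter⁺ weak? (∈-allFin v) (not-strong-inside 0 0<3)
  window⇒nonStrong {v} (there (here refl)) = ∈-filter⁺ weak? (∈-allFin v) (not-strong-inside 1 1<3)
  window⇒nonStrong {v} (there (there (here refl))) = ∈-filter⁺ weak? (∈-allFin v) (not-strong-inside 2 2<3)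

  numStrongFixed-blockPerm : numStrongFixed w + 3 ≡ n
  numStrongFixed-blockPerm = begin
    numStrongFixed w + 3                         ≡⟨ cong (numStrongFixed w +_) (sym three-nonStrong) ⟩
    numStrongFixed w + length (nonStrong w)      ≡⟨ strong+nonStrong w ⟩
    n                                            ∎
    where
    open ≡-Reasoning
    three-nonStrong : length (nonStrong w) ≡ 3
    three-nonStrong = length-by-members (Unique.filter⁺ weak? (Unique.allFin⁺ n))
                                        windowPoints-unique nonStrong⇒window window⇒nonStrong

-- Every other point v is strong, so w has
-- cuts at v and v+1; this forces cuts at all m ≤ x and at z+1, then
-- y = x+1 and z = y+1, and finally the shape of w on the window {x, y, z}.
module ThreeNonStrong {n : ℕ} (w : Vec (Fin n) n) (w-perm : IsPerm w)
  (x y z : Fin n) (x<y : toℕ x < toℕ y) (y<z : toℕ y < toℕ z)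
  (x-weak : ¬ IsStrongFixed w x) (z-weak : ¬ IsStrongFixed w z)
  (only : ∀ v → ¬ IsStrongFixed w v → v ≡ x ⊎ v ≡ y ⊎ v ≡ z) where

  open StrongFixed w w-perm

  a b c : ℕ
  a = toℕ x
  b = toℕ y
  c = toℕ z

  strong-elsewhere : ∀ v → toℕ v ≢ a → toℕ v ≢ b → toℕ v ≢ c → IsStrongFixed w v
  strong-elsewhere v v≢a v≢b v≢c with isStrongFixed? w v
  ... | yes strong = strong
  ... | no weak with only v weak
  ... | inj₁ refl = ⊥-elim (v≢a refl)
  ... | inj₂ (inj₁ refl) = ⊥-elim (v≢b refl)
  ... | inj₂ (inj₂ refl) = ⊥-elim (v≢c refl)

  cuts-elsewhere : ∀ m → m < n → m ≢ a → m ≢ b → m ≢ c → Cut m × Cut (suc m)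
  cuts-elsewhere m m<n m≢a m≢b m≢c =
    subst (λ k → Cut k × Cut (suc k)) (toℕ-fromℕ< m<n) (strong⇒cuts v (strong-elsewhere v (avoid m≢a) (avoid m≢b) (avoid m≢c)))
    where
    v = fromℕ< m<n
    avoid : ∀ {d} → m ≢ d → toℕ v ≢ d
    avoid m≢d eq = m≢d (trans (sym (toℕ-fromℕ< m<n)) eq)

  a<c : a < c
  a<c = <-trans x<y y<z

  -- Cuts at every m ≤ a (each m-1 < a is strong) and at c+1 (c+1 is strong
  -- or equal to n).
  cut-upto-a : ∀ m → m ≤ a → Cut m
  cut-upto-a zero _ = cut-zero
  cut-upto-a (suc m) m<a =
    proj₂ (cuts-elsewhere m (<-trans m<a (toℕ<n x)) (<⇒≢ m<a) (<⇒≢ (<-trans m<a x<y)) (<⇒≢ (<-trans m<a a<c)))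

  cut-a : Cut a
  cut-a = cut-upto-a a ≤-refl

  cut-after-c : Cut (suc c)
  cut-after-c with suc c <? n
  ... | yes c+1<n = proj₁ (cuts-elsewhere (suc c) c+1<n (>⇒≢ (<-trans a<c (n<1+n c))) (>⇒≢ (<-trans y<z (n<1+n c))) (>⇒≢ (n<1+n c)))
  ... | no c+1≮n = cut-beyond (suc c) (≮⇒≥ c+1≮n)

  -- y = x+1: otherwise x+1 would be strong, giving a cut at x+1 and making
  -- x strong.
  b≡a+1 : b ≡ suc a
  b≡a+1 with suc a <? b
  ... | no a+1≮b = ≤-antisym (≮⇒≥ a+1≮b) x<y
  ... | yes a+1<b = ⊥-elim (x-weak (cuts⇒strong x cut-a cut-a+1))
    where
    cut-a+1 : Cut (suc a)
    cut-a+1 = proj₁ (cuts-elsewhere (suc a) (<-trans a+1<b (toℕ<n y)) (>⇒≢ (n<1+n a)) (<⇒≢ a+1<b) (<⇒≢ (<-trans a+1<b y<z)))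

  -- z = y+1: otherwise z-1 would be strong, giving a cut at z and making z
  -- strong.
  c≡b+1 : c ≡ suc b
  c≡b+1 with suc b <? c
  ... | no b+1≮c = ≤-antisym (≮⇒≥ b+1≮c) y<z
  ... | yes b+1<c = ⊥-elim (z-weak (cuts⇒strong z (subst Cut c-1+1≡c cut-c) cut-after-c))
    where
    c-1+1≡c : suc (c ∸ 1) ≡ c
    c-1+1≡c = m+[n∸m]≡n (≤-trans (s≤s z≤n) y<z)
    b<c-1 : b < c ∸ 1
    b<c-1 = ∸-monoˡ-≤ 1 b+1<c
    cut-c : Cut (suc (c ∸ 1))
    cut-c = proj₂ (cuts-elsewhere (c ∸ 1) (<-trans (subst (c ∸ 1 <_) c-1+1≡c (n<1+n (c ∸ 1))) (toℕ<n z))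
              (>⇒≢ (<-trans x<y b<c-1)) (>⇒≢ b<c-1) (<⇒≢ (subst (c ∸ 1 <_) c-1+1≡c (n<1+n (c ∸ 1)))))

  c≡a+2 : c ≡ a + 2
  c≡a+2 = trans c≡b+1 (trans (cong suc b≡a+1) (+-comm 2 a))

  a+3≡c+1 : a + 3 ≡ suc c
  a+3≡c+1 = trans (+-suc a 2) (cong suc (sym c≡a+2))

  a+3≤n : a + 3 ≤ n
  a+3≤n = subst (_≤ n) (sym a+3≡c+1) (toℕ<n z)

  cut-a+3 : Cut (a + 3)
  cut-a+3 = subst Cut (sym a+3≡c+1) cut-after-c

  fixed-outside : ∀ v → Outside a (toℕ v) → W v ≡ v
  fixed-outside v out = strong⇒fixed v (strong-elsewhere v
    (λ v≡a → inside-not-outside a 0 0<3 (subst (Outside a) (trans v≡a (sym (+-identityʳ a))) out))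
    (λ v≡b → inside-not-outside a 1 1<3 (subst (Outside a) (trans v≡b (trans b≡a+1 (+-comm 1 a))) out))
    (λ v≡c → inside-not-outside a 2 2<3 (subst (Outside a) (trans v≡c c≡a+2) out)))

  -- The window point a + s and the offset of its image, which lies in the
  -- window again because w has cuts at a and a+3.
  at : ∀ s → s < 3 → Fin n
  at = windowPoint a a+3≤n

  toℕ-at : ∀ s s<3 → toℕ (at s s<3) ≡ a + s
  toℕ-at = toℕ-windowPoint a a+3≤n

  image-in-window : ∀ s s<3 → Σ ℕ λ t → t < 3 × toℕ (W (at s s<3)) ≡ a + t
  image-in-window s s<3 with window a (toℕ (W (at s s<3)))
  ... | outside (inj₁ W<a) =
    ⊥-elim (<⇒≱ (proj₂ (cut-a (at s s<3)) W<a) (subst (a ≤_) (sym (toℕ-at s s<3)) (m≤m+n a s)))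
  ... | outside (inj₂ a+3≤W) =
    ⊥-elim (<⇒≱ (proj₁ (cut-a+3 (at s s<3)) (subst (_< a + 3) (sym (toℕ-at s s<3)) (+-monoʳ-< a s<3))) a+3≤W)
  ... | inside t t<3 W≡a+t = t , t<3 , W≡a+t

  offset : ∀ s → s < 3 → ℕ
  offset s s<3 = proj₁ (image-in-window s s<3)

  offset<3 : ∀ s s<3 → offset s s<3 < 3
  offset<3 s s<3 = proj₁ (proj₂ (image-in-window s s<3))

  W-at : ∀ s s<3 → toℕ (W (at s s<3)) ≡ a + offset s s<3
  W-at s s<3 = proj₂ (proj₂ (image-in-window s s<3))

  offset-injective : ∀ s t s<3 t<3 → s ≢ t → offset s s<3 ≢ offset t t<3
  offset-injective s t s<3 t<3 s≢t eq = s≢t (+-cancelˡ-≡ a s t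
    (trans (sym (toℕ-at s s<3)) (trans (cong toℕ (W-injective (at s s<3) (at t t<3)
      (trans (W-at s s<3) (trans (cong (a +_) eq) (sym (W-at t t<3)))))) (toℕ-at t t<3))))

  -- If w fixed x, the cut at x would extend to x+1 and x would be strong.
  offset-0-moves : offset 0 0<3 ≢ 0
  offset-0-moves eq = x-weak (cuts⇒strong x cut-a (cut-step x x-fixed cut-a))
    where
    at-0≡x : at 0 0<3 ≡ x
    at-0≡x = toℕ-injective (trans (toℕ-at 0 0<3) (+-identityʳ a))
    x-fixed : W x ≡ x
    x-fixed = toℕ-injective (trans (cong (λ q → toℕ (W q)) (sym at-0≡x))
                            (trans (W-at 0 0<3) (trans (cong (a +_) eq) (+-identityʳ a))))

  -- If w fixed z, the cut at z+1 would restrict to z and z would be strong.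
  offset-2-moves : offset 2 2<3 ≢ 2
  offset-2-moves eq = z-weak (cuts⇒strong z (cut-unstep z z-fixed cut-after-c) cut-after-c)
    where
    at-2≡z : at 2 2<3 ≡ z
    at-2≡z = toℕ-injective (trans (toℕ-at 2 2<3) (sym c≡a+2))
    z-fixed : W z ≡ z
    z-fixed = toℕ-injective (trans (cong (λ q → toℕ (W q)) (sym at-2≡z))
                            (trans (W-at 2 2<3) (trans (cong (a +_) eq) (sym c≡a+2))))

  pattern-of-w : Σ Pattern λ σ → image σ 0 ≡ offset 0 0<3 × image σ 1 ≡ offset 1 1<3 × image σ 2 ≡ offset 2 2<3
  pattern-of-w = classify-pattern (offset 0 0<3) (offset 1 1<3) (offset 2 2<3)
    (offset<3 0 0<3) (offset<3 1 1<3) (offset<3 2 2<3)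
    (offset-injective 0 1 0<3 1<3 (λ ())) (offset-injective 0 2 0<3 2<3 (λ ())) (offset-injective 1 2 1<3 2<3 (λ ()))
    offset-0-moves offset-2-moves

  σ : Pattern
  σ = proj₁ pattern-of-w

  image≡offset : ∀ s s<3 → image σ s ≡ offset s s<3
  image≡offset 0 (s≤s z≤n) = proj₁ (proj₂ pattern-of-w)
  image≡offset 1 (s≤s (s≤s z≤n)) = proj₁ (proj₂ (proj₂ pattern-of-w))
  image≡offset 2 (s≤s (s≤s (s≤s z≤n))) = proj₂ (proj₂ (proj₂ pattern-of-w))
  image≡offset (suc (suc (suc _))) (s≤s (s≤s (s≤s ())))

  W-inside : ∀ s s<3 → toℕ (W (at s s<3)) ≡ a + image σ s
  W-inside s s<3 = trans (W-at s s<3) (cong (a +_) (sym (image≡offset s s<3)))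

  W≡shuffle : ∀ p → toℕ (W p) ≡ shuffle a σ (toℕ p)
  W≡shuffle p = by-window (window a (toℕ p))
    where
    by-window : Window a (toℕ p) → toℕ (W p) ≡ shuffle a σ (toℕ p)
    by-window (outside out) = trans (cong toℕ (fixed-outside p out)) (sym (shuffle-outside a σ (toℕ p) out))
    by-window (inside s s<3 p≡a+s) =
      trans (cong (λ q → toℕ (W q)) p≡at-s)
        (trans (W-inside s s<3) (sym (trans (cong (shuffle a σ) p≡a+s) (shuffle-inside a σ s s<3))))
      where
      p≡at-s : p ≡ at s s<3
      p≡at-s = toℕ-injective (trans p≡a+s (sym (toℕ-at s s<3)))

  w≡blockPerm : w ≡ blockPerm a a+3≤n σ
  w≡blockPerm = lookup-extensional λ p →
    toℕ-injective (trans (W≡shuffle p) (sym (blockPerm-lookup a a+3≤n σ p)))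

-- A permutation of [n] with exactly n − 3 strong fixed points is a block
-- permutation: its three non-strong points, listed in increasing order,
-- satisfy the hypotheses of ThreeNonStrong.
nonStrong-three⇒blockPerm : ∀ {n} (w : Vec (Fin n) n) → IsPerm w → numStrongFixed w + 3 ≡ n →
  Σ ℕ λ a → Σ (a + 3 ≤ n) λ a+3≤n → Σ Pattern λ σ → w ≡ blockPerm a a+3≤n σ
nonStrong-three⇒blockPerm {n} w w-perm count =
  from-list (nonStrong w) three-nonStrong
    (AllPairs.filter⁺ (∁? (isStrongFixed? w)) (AllPairs.tabulate⁺-< (λ i<j → i<j)))
    (λ v v∈ → proj₂ (∈-filter⁻ (∁? (isStrongFixed? w)) {xs = allFin n} v∈))
    (λ v weak → ∈-filter⁺ (∁? (isStrongFixed? w)) (∈-allFin v) weak)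
  where
  three-nonStrong : length (nonStrong w) ≡ 3
  three-nonStrong = +-cancelˡ-≡ (numStrongFixed w) _ _ (trans (strong+nonStrong w) (sym count))

  from-list : (l : List (Fin n)) → length l ≡ 3 → AllPairs F._<_ l →
    (∀ v → v ∈ l → ¬ IsStrongFixed w v) → (∀ v → ¬ IsStrongFixed w v → v ∈ l) →
    Σ ℕ λ a → Σ (a + 3 ≤ n) λ a+3≤n → Σ Pattern λ σ → w ≡ blockPerm a a+3≤n σ
  from-list (x ∷ y ∷ z ∷ []) refl ((x<y All.∷ _) ∷ (y<z All.∷ _) ∷ _) weak complete =
    toℕ x , a+3≤n , σ , w≡blockPerm
    where
    only : ∀ v → ¬ IsStrongFixed w v → v ≡ x ⊎ v ≡ y ⊎ v ≡ z
    only v v-weak with complete v v-weak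
    ... | here v≡x = inj₁ v≡x
    ... | there (here v≡y) = inj₂ (inj₁ v≡y)
    ... | there (there (here v≡z)) = inj₂ (inj₂ v≡z)
    open ThreeNonStrong w w-perm x y z x<y y<z (weak x (here refl)) (weak z (there (there (here refl)))) only

-- Two shuffles that agree below n (with both windows inside [0, n)) have
-- the same window and pattern: the start of the earlier window would be
-- moved by one shuffle and fixed by the other, and on a common window the
-- pattern is read off at offsets 0 and 1.
start-moved : ∀ {n} a b σ τ → a + 3 ≤ n → (∀ q → q < n → shuffle a σ q ≡ shuffle b τ q) → ¬ a < b
start-moved a b σ τ a+3≤n agree a<b = <-irrefl (sym a+σ0≡a+0) (+-monoʳ-< a (image-0-moves σ))
  where
  a+σ0≡a+0 : a + image σ 0 ≡ a + 0
  a+σ0≡a+0 = trans (sym (shuffle-inside a σ 0 0<3))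
    (trans (agree (a + 0) (<-≤-trans (+-monoʳ-< a 0<3) a+3≤n))
           (shuffle-outside b τ (a + 0) (inj₁ (subst (_< b) (sym (+-identityʳ a)) a<b))))

shuffle-parameters-unique : ∀ {n} a b σ τ → a + 3 ≤ n → b + 3 ≤ n →
  (∀ q → q < n → shuffle a σ q ≡ shuffle b τ q) → a ≡ b × σ ≡ τ
shuffle-parameters-unique a b σ τ a+3≤n b+3≤n agree with <-cmp a b
... | tri< a<b _ _ = ⊥-elim (start-moved a b σ τ a+3≤n agree a<b)
... | tri> _ _ b<a = ⊥-elim (start-moved b a τ σ b+3≤n (λ q q<n → sym (agree q q<n)) b<a)
... | tri≈ _ refl _ = refl , pattern-determined σ τ (same 0 0<3) (same 1 1<3)
  where
  same : ∀ s → s < 3 → image σ s ≡ image τ s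
  same s s<3 = +-cancelˡ-≡ a _ _ (trans (sym (shuffle-inside a σ s s<3))
    (trans (agree (a + s) (<-≤-trans (+-monoʳ-< a s<3) a+3≤n)) (shuffle-inside a τ s s<3)))

blockPerm-injective : ∀ {n} a b (a+3≤n : a + 3 ≤ n) (b+3≤n : b + 3 ≤ n) σ τ →
  blockPerm a a+3≤n σ ≡ blockPerm b b+3≤n τ → a ≡ b × σ ≡ τ
blockPerm-injective a b a+3≤n b+3≤n σ τ eq = shuffle-parameters-unique a b σ τ a+3≤n b+3≤n agree
  where
  agree : ∀ q → q < _ → shuffle a σ q ≡ shuffle b τ q
  agree q q<n = begin
    shuffle a σ q                                 ≡⟨ cong (shuffle a σ) (sym (toℕ-fromℕ< q<n)) ⟩
    shuffle a σ (toℕ P)                           ≡⟨ sym (blockPerm-lookup a a+3≤n σ P) ⟩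
    toℕ (lookup (blockPerm a a+3≤n σ) P)          ≡⟨ cong (λ v → toℕ (lookup v P)) eq ⟩
    toℕ (lookup (blockPerm b b+3≤n τ) P)          ≡⟨ blockPerm-lookup b b+3≤n τ P ⟩
    shuffle b τ (toℕ P)                           ≡⟨ cong (shuffle b τ) (toℕ-fromℕ< q<n) ⟩
    shuffle b τ q                                 ∎
    where
    open ≡-Reasoning
    P = fromℕ< q<n

windowFits : ∀ {k} (A : Fin (suc k)) → toℕ A + 3 ≤ k + 3
windowFits A = +-monoˡ-≤ 3 (s≤s⁻¹ (toℕ<n A))

blockPermAt : ∀ {k} → Fin (suc k) → Pattern → Vec (Fin (k + 3)) (k + 3)
blockPermAt A σ = blockPerm (toℕ A) (windowFits A) σ

blockPerms : ∀ k → List (Vec (Fin (k + 3)) (k + 3))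
blockPerms k = cartesianProductWith blockPermAt (allFin (suc k)) patterns

blockPerms-unique : ∀ k → Unique (blockPerms k)
blockPerms-unique k = Unique.cartesianProductWith⁺ blockPermAt distinct (Unique.allFin⁺ (suc k)) patterns-unique
  where
  distinct : ∀ {A B σ τ} → blockPermAt A σ ≡ blockPermAt B τ → A ≡ B × σ ≡ τ
  distinct {A} {B} {σ} {τ} eq with blockPerm-injective (toℕ A) (toℕ B) (windowFits A) (windowFits B) σ τ eq
  ... | A≡B , σ≡τ = toℕ-injective A≡B , σ≡τ

St≡length-blockPerms : ∀ k → St (k + 3) k ≡ length (blockPerms k)
St≡length-blockPerms k =
  length-by-members (Unique.filter⁺ has-k? (perms-unique (k + 3))) (blockPerms-unique k) has-k⇒block block⇒has-k
  where
  has-k? = λ (w : Vec (Fin (k + 3)) (k + 3)) → numStrongFixed w ℕ.≟ k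

  has-k⇒block : ∀ {w} → w ∈ filter has-k? (perms (k + 3)) → w ∈ blockPerms k
  has-k⇒block {w} w∈ with ∈-filter⁻ has-k? {xs = perms (k + 3)} w∈
  ... | w∈perms , has-k with nonStrong-three⇒blockPerm w (proj₂ (∈-filter⁻ isPerm? {xs = allVecs _ _} w∈perms)) (cong (_+ 3) has-k)
  ... | a , a+3≤k+3 , σ , refl =
    subst (_∈ blockPerms k) (same-window (toℕ-fromℕ< a<k+1) {windowFits (fromℕ< a<k+1)})
      (∈-cartesianProductWith⁺ blockPermAt (∈-allFin (fromℕ< a<k+1)) (patterns-complete σ))
    where
    a<k+1 : a < suc k
    a<k+1 = s≤s (+-cancelʳ-≤ 3 a k a+3≤k+3)
    same-window : ∀ {b} → b ≡ a → ∀ {b+3≤k+3} → blockPerm b b+3≤k+3 σ ≡ blockPerm a a+3≤k+3 σ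
    same-window refl = refl

  block⇒has-k : ∀ {w} → w ∈ blockPerms k → w ∈ filter has-k? (perms (k + 3))
  block⇒has-k {w} w∈ with ∈-cartesianProductWith⁻ blockPermAt (allFin (suc k)) patterns w∈
  ... | A , σ , _ , _ , refl =
    ∈-filter⁺ has-k? (perms-complete w (blockPerm-isPerm (toℕ A) (windowFits A) σ))
      (+-cancelʳ-≡ 3 (numStrongFixed w) k (BlockPermStrong.numStrongFixed-blockPerm (toℕ A) (windowFits A) σ))

corollary3 : (k : ℕ) → St (k + 3) k ≡ 3 * (k + 1)
corollary3 k = begin
  St (k + 3) k                   ≡⟨ St≡length-blockPerms k ⟩
  length (blockPerms k)          ≡⟨ length-cartesianProductWith blockPermAt (allFin (suc k)) patterns ⟩
  length (allFin (suc k)) * 3    ≡⟨ cong (_* 3) (length-tabulate {n = suc k} (λ i → i)) ⟩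
  suc k * 3                      ≡⟨ *-comm (suc k) 3 ⟩
  3 * suc k                      ≡⟨ cong (3 *_) (+-comm 1 k) ⟩
  3 * (k + 1)                    ∎
  where open ≡-Reasoning
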